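{- Let $\mathtt{T}_1,\mathtt{T}_2,\mathtt{T}_3,\mathtt{S}_1,\mathtt{S}_2$ be modal trees, and write $\mathtt{A}\overset{*}{\leftrightarrow}\mathtt{B}$ for ($\mathtt{A}\hookrightarrow^*\mathtt{B}$ and $\mathtt{B}\hookrightarrow^*\mathtt{A}$). Then: (1) $\mathtt{T}_1\overset{*}{\leftrightarrow}\mathtt{T}_1+\mathtt{T}_1$; (2) $\mathtt{T}_1+\mathtt{T}_2\overset{*}{\leftrightarrow}\mathtt{T}_2+\mathtt{T}_1$; (3) $\mathtt{T}_1+\mathtt{T}_2\hookrightarrow^*\mathtt{T}_1$ and $\mathtt{T}_1+\mathtt{T}_2\hookrightarrow^*\mathtt{T}_2$; (4) if $\mathtt{T}_1\hookrightarrow^*\mathtt{S}_1$ then $\mathtt{T}_1+\mathtt{T}_2\hookrightarrow^*\mathtt{S}_1+\mathtt{T}_2$; (5) if $\mathtt{T}_1\hookrightarrow^*\mathtt{T}_2$ and $\mathtt{T}_1\hookrightarrow^*\mathtt{T}_3$ then $\mathtt{T}_1\hookrightarrow^*\mathtt{T}_2+\mathtt{T}_3$; (6) if $\mathtt{S}_1\hookrightarrow^*\mathtt{T}_1$ and $\mathtt{S}_2\hookrightarrow^*\mathtt{T}_2$ then $\mathtt{S}_1+\mathtt{S}_2\hookrightarrow^*\mathtt{T}_1+\mathtt{T}_2$.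
   Context: Modal trees: recursively, pairs $\langle\Delta;\Gamma\rangle$ with $\Delta$ a finite list of propositional variables and $\Gamma$ a finite list of pairs $(\alpha,\mathtt{S})$, $\alpha<\omega$, $\mathtt{S}$ a modal tree. Sum: $\langle\Delta_1;\Gamma_1\rangle+\langle\Delta_2;\Gamma_2\rangle=\langle\Delta_1\frown\Delta_2;\Gamma_1\frown\Gamma_2\rangle$. Positions: $\mathrm{Pos}(\langle\Delta;\varnothing\rangle)=\{\epsilon\}$; $\mathrm{Pos}(\langle\Delta;[(\alpha_1,\mathtt{S}_1),\dots,(\alpha_n,\mathtt{S}_n)]\rangle)=\{\epsilon\}\cup\bigcup_{i=1}^n\{i\mathbf{k}\mid\mathbf{k}\in\mathrm{Pos}(\mathtt{S}_i)\}$. Subtree: $\mathtt{T}|_\epsilon=\mathtt{T}$, $\mathtt{T}|_{i\mathbf{r}}=\mathtt{S}_i|_{\mathbf{r}}$. Replacement: $\mathtt{T}[\mathtt{S}]_\epsilon=\mathtt{S}$, $\mathtt{T}[\mathtt{S}]_{i\mathbf{r}}$ is $\mathtt{T}$ with its $i$-th child $\mathtt{S}_i$ replaced by $\mathtt{S}_i[\mathtt{S}]_{\mathbf{r}}$ (same edge label). List operations, for $0<i,j\le|\Gamma|$: $\#_i\Gamma$ is the $i$-th element; $\Gamma^{ -i}$ deletes it; $\Gamma^{+i}=(\#_i\Gamma)\frown\Gamma$; $\Gamma[x]_i$ replaces the $i$-th element by $x$; $\Gamma^{i\leftrightarrow j}$ swaps the $i$-th and $j$-th elements; similarly $\Delta^{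 -n},\Delta^{+n}$. $\mathsf{TRC}$ rules: for a modal tree $\mathtt{T}$, $\mathbf{k}\in\mathrm{Pos}(\mathtt{T})$ with $\mathtt{T}|_\mathbf{k}=\langle\Delta;\Gamma\rangle$: ($\rho^+$) $\mathtt{T}\hookrightarrow\mathtt{T}[\langle\Delta^{+i};\Gamma\rangle]_\mathbf{k}$, $0<i\le|\Delta|$; ($\rho^-$) $\mathtt{T}\hookrightarrow\mathtt{T}[\langle\Delta^{ -i};\Gamma\rangle]_\mathbf{k}$; ($\sigma$) $\mathtt{T}\hookrightarrow\mathtt{T}[\langle\Delta;\Gamma^{i\leftrightarrow j}\rangle]_\mathbf{k}$, $i\neq j$; ($\pi^+$) $\mathtt{T}\hookrightarrow\mathtt{T}[\langle\Delta;\Gamma^{+i}\rangle]_\mathbf{k}$; ($\pi^-$) $\mathtt{T}\hookrightarrow\mathtt{T}[\langle\Delta;\Gamma^{ -i}\rangle]_\mathbf{k}$; ($\mathfrak{4}$) if $\#_i\Gamma=(\beta,\langle\tilde\Delta;\tilde\Gamma\rangle)$ and $\#_j\tilde\Gamma=(\beta,\mathtt{S})$, then $\mathtt{T}\hookrightarrow\mathtt{T}[\langle\Delta;\Gamma[(\beta,\mathtt{S})]_i\rangle]_\mathbf{k}$; ($\lambda$) if $\#_i\Gamma=(\alpha,\mathtt{S})$ and $\alpha>\beta$, then $\mathtt{T}\hookrightarrow\mathtt{T}[\langle\Delta;\Gamma[(\beta,\mathtt{S})]_i\rangle]_\mathbf{k}$; ($\mathsf{J}$) if $i\ne j$, $\#_i\Gamma=(\alpha,\langle\tilde\Delta;\tilde\Gamma\rangle)$,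 $\#_j\Gamma=(\beta,\mathtt{S})$, $\alpha>\beta$, then $\mathtt{T}\hookrightarrow\mathtt{T}[\langle\Delta;(\Gamma[(\alpha,\langle\tilde\Delta;\tilde\Gamma\frown(\beta,\mathtt{S})\rangle)]_i)^{ -j}\rangle]_\mathbf{k}$. $\hookrightarrow$ is the union of these relations, $\hookrightarrow^*$ its reflexive-transitive closure. -}

module Defs where

open import Data.Nat using (ℕ; zero; suc; _<_)
open import Data.Fin using (Fin; zero; suc; cast)
open import Data.Fin.Permutation.Components using (transpose)
open import Data.List using (List; []; _∷_; _++_; [_]; length; lookup; removeAt; tabulate; _[_]∷=_)
open import Data.Maybe using (Maybe; just; nothing)
open import Data.Product using (_×_; _,_; ∃; ∃-syntax)
open import Relation.Binary.PropositionalEquality using (_≡_; refl; cong)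
open import Relation.Binary.Construct.Closure.ReflexiveTransitive using (Star)
open import Relation.Nullary using (¬_)

PropVar : Set
PropVar = ℕ

-- Modal tree ⟨Δ;Γ⟩ : Δ a list of propositional variables,
-- Γ a list of pairs (α , S) with α < ω and S a modal tree.
data Tree : Set where
  ⟨_⨾_⟩ : List PropVar → List (ℕ × Tree) → Tree

_⊕_ : Tree → Tree → Tree
⟨ Δ₁ ⨾ Γ₁ ⟩ ⊕ ⟨ Δ₂ ⨾ Γ₂ ⟩ = ⟨ Δ₁ ++ Δ₂ ⨾ Γ₁ ++ Γ₂ ⟩

-- Positions are lists of 1-based child indices (ε = []).
Position : Set
Position = List ℕ

mutual
  subtree : Tree → Position → Maybe Tree
  subtree T [] = just T
  subtree ⟨ Δ ⨾ Γ ⟩ (i ∷ r) = subtreeIn Γ i r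

  subtreeIn : List (ℕ × Tree) → ℕ → Position → Maybe Tree
  subtreeIn [] i r = nothing
  subtreeIn ((α , S) ∷ Γ) zero r = nothing
  subtreeIn ((α , S) ∷ Γ) (suc zero) r = subtree S r
  subtreeIn ((α , S) ∷ Γ) (suc (suc i)) r = subtreeIn Γ (suc i) r

_∈Pos_ : Position → Tree → Set
k ∈Pos T = ∃[ S ] (subtree T k ≡ just S)

mutual
  replace : Tree → Tree → Position → Tree
  replace T S [] = S
  replace ⟨ Δ ⨾ Γ ⟩ S (i ∷ r) = ⟨ Δ ⨾ replaceIn Γ S i r ⟩

  replaceIn : List (ℕ × Tree) → Tree → ℕ → Position → List (ℕ × Tree)
  replaceIn [] S i r = []
  replaceIn ((α , U) ∷ Γ) S zero r = (α , U) ∷ Γ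
  replaceIn ((α , U) ∷ Γ) S (suc zero) r = (α , replace U S r) ∷ Γ
  replaceIn ((α , U) ∷ Γ) S (suc (suc i)) r = (α , U) ∷ replaceIn Γ S (suc i) r

-- List operations (indices are Fin (length _), i.e. 0-based versions of 0<i≤|Γ|).
_⁺ : ∀ {A : Set} (xs : List A) → Fin (length xs) → List A
(xs ⁺) i = lookup xs i ∷ xs

swap : ∀ {A : Set} (xs : List A) → Fin (length xs) → Fin (length xs) → List A
swap xs i j = tabulate (λ k → lookup xs (transpose i j k))

length-∷= : ∀ {A : Set} (xs : List A) (i : Fin (length xs)) (x : A) →
            length (xs [ i ]∷= x) ≡ length xs
length-∷= (y ∷ ys) zero x = refl
length-∷= (y ∷ ys) (suc i) x = cong suc (length-∷= ys i x)

data LocalStep : Tree → Tree → Set where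
  ρ⁺ : ∀ {Δ Γ} (i : Fin (length Δ)) → LocalStep ⟨ Δ ⨾ Γ ⟩ ⟨ (Δ ⁺) i ⨾ Γ ⟩
  ρ⁻ : ∀ {Δ Γ} (i : Fin (length Δ)) → LocalStep ⟨ Δ ⨾ Γ ⟩ ⟨ removeAt Δ i ⨾ Γ ⟩
  σ  : ∀ {Δ Γ} (i j : Fin (length Γ)) → ¬ i ≡ j →
       LocalStep ⟨ Δ ⨾ Γ ⟩ ⟨ Δ ⨾ swap Γ i j ⟩
  π⁺ : ∀ {Δ Γ} (i : Fin (length Γ)) → LocalStep ⟨ Δ ⨾ Γ ⟩ ⟨ Δ ⨾ (Γ ⁺) i ⟩
  π⁻ : ∀ {Δ Γ} (i : Fin (length Γ)) → LocalStep ⟨ Δ ⨾ Γ ⟩ ⟨ Δ ⨾ removeAt Γ i ⟩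
  rule4 : ∀ {Δ Γ} (i : Fin (length Γ)) {β Δ̃ Γ̃} →
       lookup Γ i ≡ (β , ⟨ Δ̃ ⨾ Γ̃ ⟩) →
       (j : Fin (length Γ̃)) {S : Tree} → lookup Γ̃ j ≡ (β , S) →
       LocalStep ⟨ Δ ⨾ Γ ⟩ ⟨ Δ ⨾ Γ [ i ]∷= (β , S) ⟩
  λ-rule : ∀ {Δ Γ} (i : Fin (length Γ)) {α S} → lookup Γ i ≡ (α , S) →
       (β : ℕ) → β < α →
       LocalStep ⟨ Δ ⨾ Γ ⟩ ⟨ Δ ⨾ Γ [ i ]∷= (β , S) ⟩
  J  : ∀ {Δ Γ} (i j : Fin (length Γ)) → ¬ i ≡ j →
       ∀ {α Δ̃ Γ̃ β S} →
       lookup Γ i ≡ (α , ⟨ Δ̃ ⨾ Γ̃ ⟩) → lookup Γ j ≡ (β , S) → β < α →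
       LocalStep ⟨ Δ ⨾ Γ ⟩
         ⟨ Δ ⨾ removeAt (Γ [ i ]∷= (α , ⟨ Δ̃ ⨾ Γ̃ ++ [ (β , S) ] ⟩))
                        (cast (Relation.Binary.PropositionalEquality.sym
                                (length-∷= Γ i (α , ⟨ Δ̃ ⨾ Γ̃ ++ [ (β , S) ] ⟩))) j) ⟩

data _↪_ : Tree → Tree → Set where
  step : ∀ {T U V} (k : Position) → subtree T k ≡ just U → LocalStep U V →
         T ↪ replace T V k

_↪*_ : Tree → Tree → Set
_↪*_ = Star _↪_

_↔*_ : Tree → Tree → Set
A ↔* B = (A ↪* B) × (B ↪* A)

{-# OPTIONS --safe #-}
module Submission where

-- At the root of a tree the structural rules ρ± and π± can replace the
-- variable list and the box list by any lists with no new entries: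
-- duplicate the wanted entries to the front, then delete the old ones.
-- Parts (1)–(3) are instances of this.  For (4), every step of T₁ is a
-- step of T₁ ⊕ T₂: the children of T₁ come first in the sum, so positions
-- inside T₁ keep their indices, and at the root the structural rules only
-- shrink the entry sets while 4, λ and J act on entries of T₁ at the same
-- indices.  Part (6) is (4) on each summand together with commutativity,
-- and (5) is (1) followed by (6).

open import Defs
open import Function using (_∘_)
open import Data.Product using (_×_; _,_)
open import Data.Sum using ([_,_]′)
open import Data.Nat using (ℕ; zero; suc)
open import Data.Fin using (Fin; zero; suc; toℕ; cast)
open import Data.Fin.Properties using (toℕ-cast; toℕ-injective; suc-injective)
open import Data.List using (List; []; _∷_; _++_; [_]; length; lookup; removeAt; _[_]∷=_)
open import Data.List.Properties using (++-identityʳ)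
open import Data.List.Relation.Unary.Any using (here; there; index)
open import Data.List.Relation.Unary.Any.Properties using (lookup-index)
open import Data.List.Membership.Propositional using (_∈_)
open import Data.List.Membership.Propositional.Properties using (∈-lookup; ∈-tabulate⁻; ∈-++⁻; ∈-++⁺ʳ)
open import Data.List.Relation.Binary.Subset.Propositional using (_⊆_)
open import Data.List.Relation.Binary.Subset.Propositional.Properties
  using (⊆-refl; ⊆-trans; xs⊆xs++ys; xs⊆ys++xs; ∈-∷⁺ʳ)
open import Data.Maybe using (just)
open import Relation.Binary.PropositionalEquality using (_≡_; refl; cong; sym; trans; subst; module ≡-Reasoning)
open import Relation.Binary.Construct.Closure.ReflexiveTransitive using (Star; ε; _◅_; _◅◅_; gmap; kleisliStar)

module _ {A : Set} where

  inject++ : ∀ (xs ys : List A) → Fin (length xs) → Fin (length (xs ++ ys))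
  inject++ (x ∷ xs) ys zero    = zero
  inject++ (x ∷ xs) ys (suc i) = suc (inject++ xs ys i)

  raise++ : ∀ (xs : List A) {ys} → Fin (length ys) → Fin (length (xs ++ ys))
  raise++ []       i = i
  raise++ (x ∷ xs) i = suc (raise++ xs i)

  toℕ-inject++ : ∀ xs ys i → toℕ (inject++ xs ys i) ≡ toℕ i
  toℕ-inject++ (x ∷ xs) ys zero    = refl
  toℕ-inject++ (x ∷ xs) ys (suc i) = cong suc (toℕ-inject++ xs ys i)

  inject++-injective : ∀ xs ys {i j} → inject++ xs ys i ≡ inject++ xs ys j → i ≡ j
  inject++-injective (x ∷ xs) ys {zero}  {zero}  eq = refl
  inject++-injective (x ∷ xs) ys {suc i} {suc j} eq = cong suc (inject++-injective xs ys (suc-injective eq))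

  lookup-inject++ : ∀ xs ys i → lookup (xs ++ ys) (inject++ xs ys i) ≡ lookup xs i
  lookup-inject++ (x ∷ xs) ys zero    = refl
  lookup-inject++ (x ∷ xs) ys (suc i) = lookup-inject++ xs ys i

  ∷=-inject++ : ∀ xs ys i (v : A) → (xs ++ ys) [ inject++ xs ys i ]∷= v ≡ (xs [ i ]∷= v) ++ ys
  ∷=-inject++ (x ∷ xs) ys zero    v = refl
  ∷=-inject++ (x ∷ xs) ys (suc i) v = cong (x ∷_) (∷=-inject++ xs ys i v)

  removeAt-inject++ : ∀ xs ys i → removeAt (xs ++ ys) (inject++ xs ys i) ≡ removeAt xs i ++ ys
  removeAt-inject++ (x ∷ xs) ys zero    = refl
  removeAt-inject++ (x ∷ xs) ys (suc i) = cong (x ∷_) (removeAt-inject++ xs ys i)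

  removeAt-raise++ : ∀ xs {ys} i → removeAt (xs ++ ys) (raise++ xs i) ≡ xs ++ removeAt ys i
  removeAt-raise++ []       i = refl
  removeAt-raise++ (x ∷ xs) i = cong (x ∷_) (removeAt-raise++ xs i)

  removeAt-cong : ∀ {xs ys : List A} {i j} → xs ≡ ys → toℕ i ≡ toℕ j → removeAt xs i ≡ removeAt ys j
  removeAt-cong {xs} refl eq = cong (removeAt xs) (toℕ-injective eq)

  ⁺-⊆ : ∀ (xs : List A) i → (xs ⁺) i ⊆ xs
  ⁺-⊆ xs i = ∈-∷⁺ʳ (∈-lookup i) ⊆-refl

  removeAt-⊆ : ∀ (xs : List A) i → removeAt xs i ⊆ xs
  removeAt-⊆ (x ∷ xs) zero    p         = there p
  removeAt-⊆ (x ∷ xs) (suc i) (here eq) = here eq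
  removeAt-⊆ (x ∷ xs) (suc i) (there p) = there (removeAt-⊆ xs i p)

  swap-⊆ : ∀ (xs : List A) i j → swap xs i j ⊆ xs
  swap-⊆ xs i j p with ∈-tabulate⁻ p
  ... | k , refl = ∈-lookup _

  ++-lub : ∀ {xs ys zs : List A} → xs ⊆ zs → ys ⊆ zs → xs ++ ys ⊆ zs
  ++-lub {xs} s t = [ s , t ]′ ∘ ∈-++⁻ xs

  data DupDel : List A → List A → Set where
    dup : ∀ {xs} (i : Fin (length xs)) → DupDel xs ((xs ⁺) i)
    del : ∀ {xs} (i : Fin (length xs)) → DupDel xs (removeAt xs i)

  dup-∈ : ∀ {x xs} → x ∈ xs → DupDel xs (x ∷ xs)
  dup-∈ {xs = xs} p = subst (λ y → DupDel xs (y ∷ xs)) (sym (lookup-index p)) (dup (index p))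

  dupDel-prepend : ∀ ys {xs} → ys ⊆ xs → Star DupDel xs (ys ++ xs)
  dupDel-prepend []       s = ε
  dupDel-prepend (y ∷ ys) s =
    dupDel-prepend ys (s ∘ there) ◅◅ dup-∈ (∈-++⁺ʳ ys (s (here refl))) ◅ ε

  dupDel-dropSuffix : ∀ ys zs → Star DupDel (ys ++ zs) ys
  dupDel-dropSuffix ys []       = subst (λ xs → Star DupDel xs ys) (sym (++-identityʳ ys)) ε
  dupDel-dropSuffix ys (z ∷ zs) =
    subst (DupDel (ys ++ z ∷ zs)) (removeAt-raise++ ys zero) (del (raise++ ys zero))
      ◅ dupDel-dropSuffix ys zs

  ⊆⇒dupDel* : ∀ {xs ys} → ys ⊆ xs → Star DupDel xs ys
  ⊆⇒dupDel* {xs} {ys} s = dupDel-prepend ys s ◅◅ dupDel-dropSuffix ys xs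

rootStep : ∀ {U V} → LocalStep U V → U ↪ V
rootStep = step [] refl

_⊑_ : Tree → Tree → Set
⟨ Δ ⨾ Γ ⟩ ⊑ ⟨ Δ′ ⨾ Γ′ ⟩ = Δ ⊆ Δ′ × Γ ⊆ Γ′

⊑-refl : ∀ T → T ⊑ T
⊑-refl ⟨ Δ ⨾ Γ ⟩ = ⊆-refl , ⊆-refl

⊑-trans : ∀ T U V → T ⊑ U → U ⊑ V → T ⊑ V
⊑-trans ⟨ _ ⨾ _ ⟩ ⟨ _ ⨾ _ ⟩ ⟨ _ ⨾ _ ⟩ (s , t) (s′ , t′) = ⊆-trans s s′ , ⊆-trans t t′

⊑-⊕ˡ : ∀ T₁ T₂ → T₁ ⊑ (T₁ ⊕ T₂)
⊑-⊕ˡ ⟨ Δ₁ ⨾ Γ₁ ⟩ ⟨ Δ₂ ⨾ Γ₂ ⟩ = xs⊆xs++ys Δ₁ Δ₂ , xs⊆xs++ys Γ₁ Γ₂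

⊑-⊕ʳ : ∀ T₁ T₂ → T₂ ⊑ (T₁ ⊕ T₂)
⊑-⊕ʳ ⟨ Δ₁ ⨾ Γ₁ ⟩ ⟨ Δ₂ ⨾ Γ₂ ⟩ = xs⊆ys++xs Δ₂ Δ₁ , xs⊆ys++xs Γ₂ Γ₁

⊕-lub : ∀ T₁ T₂ U → T₁ ⊑ U → T₂ ⊑ U → (T₁ ⊕ T₂) ⊑ U
⊕-lub ⟨ _ ⨾ _ ⟩ ⟨ _ ⨾ _ ⟩ ⟨ _ ⨾ _ ⟩ (s , t) (s′ , t′) = ++-lub s s′ , ++-lub t t′

⊕-monoˡ-⊑ : ∀ T U V → T ⊑ U → (T ⊕ V) ⊑ (U ⊕ V)
⊕-monoˡ-⊑ T U V T⊑U = ⊕-lub T V (U ⊕ V) (⊑-trans T U (U ⊕ V) T⊑U (⊑-⊕ˡ U V)) (⊑-⊕ʳ U V)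

⊑⇒↪* : ∀ T U → T ⊑ U → U ↪* T
⊑⇒↪* ⟨ Δ′ ⨾ Γ′ ⟩ ⟨ Δ ⨾ Γ ⟩ (s , t) = onΔ (⊆⇒dupDel* s) ◅◅ onΓ (⊆⇒dupDel* t)
  where
  onΔ : Star DupDel Δ Δ′ → ⟨ Δ ⨾ Γ ⟩ ↪* ⟨ Δ′ ⨾ Γ ⟩
  onΔ = gmap ⟨_⨾ Γ ⟩ λ { (dup i) → rootStep (ρ⁺ i) ; (del i) → rootStep (ρ⁻ i) }
  onΓ : Star DupDel Γ Γ′ → ⟨ Δ′ ⨾ Γ ⟩ ↪* ⟨ Δ′ ⨾ Γ′ ⟩
  onΓ = gmap ⟨ Δ′ ⨾_⟩ λ { (dup i) → rootStep (π⁺ i) ; (del i) → rootStep (π⁻ i) }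

subtreeIn-++ : ∀ Γ Γ₂ i r {U} → subtreeIn Γ i r ≡ just U → subtreeIn (Γ ++ Γ₂) i r ≡ just U
subtreeIn-++ ((α , S) ∷ Γ) Γ₂ (suc zero)    r eq = eq
subtreeIn-++ ((α , S) ∷ Γ) Γ₂ (suc (suc i)) r eq = subtreeIn-++ Γ Γ₂ (suc i) r eq

replaceIn-++ : ∀ Γ Γ₂ V i r {U} → subtreeIn Γ i r ≡ just U →
               replaceIn (Γ ++ Γ₂) V i r ≡ replaceIn Γ V i r ++ Γ₂
replaceIn-++ ((α , S) ∷ Γ) Γ₂ V (suc zero)    r eq = refl
replaceIn-++ ((α , S) ∷ Γ) Γ₂ V (suc (suc i)) r eq = cong ((α , S) ∷_) (replaceIn-++ Γ Γ₂ V (suc i) r eq)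

⊑⇒⊕ʳ-↪* : ∀ T U V → V ⊑ U → (U ⊕ T) ↪* (V ⊕ T)
⊑⇒⊕ʳ-↪* T U V V⊑U = ⊑⇒↪* (V ⊕ T) (U ⊕ T) (⊕-monoˡ-⊑ V U T V⊑U)

localStep-⊕ʳ : ∀ {U V} T → LocalStep U V → (U ⊕ T) ↪* (V ⊕ T)
localStep-⊕ʳ {U} {V} T (ρ⁺ i)    = ⊑⇒⊕ʳ-↪* T U V (⁺-⊆ _ i , ⊆-refl)
localStep-⊕ʳ {U} {V} T (ρ⁻ i)    = ⊑⇒⊕ʳ-↪* T U V (removeAt-⊆ _ i , ⊆-refl)
localStep-⊕ʳ {U} {V} T (σ i j _) = ⊑⇒⊕ʳ-↪* T U V (⊆-refl , swap-⊆ _ i j)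
localStep-⊕ʳ {U} {V} T (π⁺ i)    = ⊑⇒⊕ʳ-↪* T U V (⊆-refl , ⁺-⊆ _ i)
localStep-⊕ʳ {U} {V} T (π⁻ i)    = ⊑⇒⊕ʳ-↪* T U V (⊆-refl , removeAt-⊆ _ i)
localStep-⊕ʳ {⟨ Δ ⨾ Γ ⟩} ⟨ Δ₂ ⨾ Γ₂ ⟩ (rule4 i eq j eq′) =
  rootStep (subst (LocalStep _) (cong ⟨ Δ ++ Δ₂ ⨾_⟩ (∷=-inject++ Γ Γ₂ i _))
    (rule4 (inject++ Γ Γ₂ i) (trans (lookup-inject++ Γ Γ₂ i) eq) j eq′)) ◅ ε
localStep-⊕ʳ {⟨ Δ ⨾ Γ ⟩} ⟨ Δ₂ ⨾ Γ₂ ⟩ (λ-rule i eq β β<α) =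
  rootStep (subst (LocalStep _) (cong ⟨ Δ ++ Δ₂ ⨾_⟩ (∷=-inject++ Γ Γ₂ i _))
    (λ-rule (inject++ Γ Γ₂ i) (trans (lookup-inject++ Γ Γ₂ i) eq) β β<α)) ◅ ε
localStep-⊕ʳ {⟨ Δ ⨾ Γ ⟩} ⟨ Δ₂ ⨾ Γ₂ ⟩ (J i j i≢j {α} {Δ̃} {Γ̃} {β} {S} eqᵢ eqⱼ β<α) =
  rootStep (subst (LocalStep _) (cong ⟨ Δ ++ Δ₂ ⨾_⟩ removeAt-∷=-inject++)
    (J (inject++ Γ Γ₂ i) (inject++ Γ Γ₂ j) (i≢j ∘ inject++-injective Γ Γ₂)
       (trans (lookup-inject++ Γ Γ₂ i) eqᵢ) (trans (lookup-inject++ Γ Γ₂ j) eqⱼ) β<α)) ◅ ε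
  where
  open ≡-Reasoning
  x : ℕ × Tree
  x = (α , ⟨ Δ̃ ⨾ Γ̃ ++ [ (β , S) ] ⟩)
  removeAt-∷=-inject++ : removeAt ((Γ ++ Γ₂) [ inject++ Γ Γ₂ i ]∷= x) (cast _ (inject++ Γ Γ₂ j))
                       ≡ removeAt (Γ [ i ]∷= x) (cast _ j) ++ Γ₂
  removeAt-∷=-inject++ = trans
    (removeAt-cong (∷=-inject++ Γ Γ₂ i x) (begin
      toℕ (cast _ (inject++ Γ Γ₂ j))                  ≡⟨ toℕ-cast _ (inject++ Γ Γ₂ j) ⟩
      toℕ (inject++ Γ Γ₂ j)                           ≡⟨ toℕ-inject++ Γ Γ₂ j ⟩
      toℕ j                                           ≡⟨ sym (toℕ-cast _ j) ⟩
      toℕ (cast _ j)                                  ≡⟨ sym (toℕ-inject++ (Γ [ i ]∷= x) Γ₂ (cast _ j)) ⟩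
      toℕ (inject++ (Γ [ i ]∷= x) Γ₂ (cast _ j))      ∎))
    (removeAt-inject++ (Γ [ i ]∷= x) Γ₂ (cast _ j))

↪-⊕ʳ : ∀ {T₁ S₁} T₂ → T₁ ↪ S₁ → (T₁ ⊕ T₂) ↪* (S₁ ⊕ T₂)
↪-⊕ʳ {⟨ Δ ⨾ Γ ⟩} ⟨ Δ₂ ⨾ Γ₂ ⟩ (step []      refl l) = localStep-⊕ʳ ⟨ Δ₂ ⨾ Γ₂ ⟩ l
↪-⊕ʳ {⟨ Δ ⨾ Γ ⟩} ⟨ Δ₂ ⨾ Γ₂ ⟩ (step {V = V} (i ∷ r) eq l) =
  subst (⟨ Δ ++ Δ₂ ⨾ Γ ++ Γ₂ ⟩ ↪_) (cong ⟨ Δ ++ Δ₂ ⨾_⟩ (replaceIn-++ Γ Γ₂ V i r eq))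
    (step (i ∷ r) (subtreeIn-++ Γ Γ₂ i r eq) l) ◅ ε

↪*-⊕ʳ : ∀ {T₁ S₁} T₂ → T₁ ↪* S₁ → (T₁ ⊕ T₂) ↪* (S₁ ⊕ T₂)
↪*-⊕ʳ T₂ = kleisliStar (_⊕ T₂) (↪-⊕ʳ T₂)

⊕-comm-↪* : ∀ T₁ T₂ → (T₁ ⊕ T₂) ↪* (T₂ ⊕ T₁)
⊕-comm-↪* T₁ T₂ = ⊑⇒↪* (T₂ ⊕ T₁) (T₁ ⊕ T₂) (⊕-lub T₂ T₁ (T₁ ⊕ T₂) (⊑-⊕ʳ T₁ T₂) (⊑-⊕ˡ T₁ T₂))

↪*-⊕ : ∀ {S₁ S₂ T₁ T₂} → S₁ ↪* T₁ → S₂ ↪* T₂ → (S₁ ⊕ S₂) ↪* (T₁ ⊕ T₂)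
↪*-⊕ {S₁} {S₂} {T₁} {T₂} S₁↪*T₁ S₂↪*T₂ =
  ↪*-⊕ʳ S₂ S₁↪*T₁ ◅◅ ⊕-comm-↪* T₁ S₂ ◅◅ ↪*-⊕ʳ T₁ S₂↪*T₂ ◅◅ ⊕-comm-↪* T₂ T₁

↪*-⊕-self : ∀ T → T ↪* (T ⊕ T)
↪*-⊕-self T = ⊑⇒↪* (T ⊕ T) T (⊕-lub T T T (⊑-refl T) (⊑-refl T))

mainTheorem14 : (T₁ T₂ T₃ S₁ S₂ : Tree) →
    (T₁ ↔* (T₁ ⊕ T₁))
    × ((T₁ ⊕ T₂) ↔* (T₂ ⊕ T₁))
    × (((T₁ ⊕ T₂) ↪* T₁) × ((T₁ ⊕ T₂) ↪* T₂))
    × ((T₁ ↪* S₁) → (T₁ ⊕ T₂) ↪* (S₁ ⊕ T₂))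
    × ((T₁ ↪* T₂) → (T₁ ↪* T₃) → T₁ ↪* (T₂ ⊕ T₃))
    × ((S₁ ↪* T₁) → (S₂ ↪* T₂) → (S₁ ⊕ S₂) ↪* (T₁ ⊕ T₂))
mainTheorem14 T₁ T₂ T₃ S₁ S₂ =
  (↪*-⊕-self T₁ , ⊑⇒↪* T₁ (T₁ ⊕ T₁) (⊑-⊕ˡ T₁ T₁)) ,
  (⊕-comm-↪* T₁ T₂ , ⊕-comm-↪* T₂ T₁) ,
  (⊑⇒↪* T₁ (T₁ ⊕ T₂) (⊑-⊕ˡ T₁ T₂) , ⊑⇒↪* T₂ (T₁ ⊕ T₂) (⊑-⊕ʳ T₁ T₂)) ,
  ↪*-⊕ʳ T₂ ,
  (λ T₁↪*T₂ T₁↪*T₃ → ↪*-⊕-self T₁ ◅◅ ↪*-⊕ T₁↪*T₂ T₁↪*T₃) ,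
  ↪*-⊕
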